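{- Let $H$ be a hypergraph on a nonempty finite set $X$. Then $H$ is connected if and only if the boolean function $\gamma(H):A\mapsto|\{Y\in E(H):Y\subseteq A\}|$ is indecomposable.
   Context: A hypergraph $H$ on $X$ is a set $E(H)\subseteq\mathcal{P}(X)$ not containing $\emptyset$. $H$ is connected if for every partition $X=X'\sqcup X''$ into nonempty sets there is $Y\in E(H)$ meeting both $X'$ and $X''$. A boolean function on $X$ is $f:\mathcal{P}(X)\to\mathbb{Z}$ with $f(\emptyset)=0$; $\mathrm{Bool}(X)$ is their set. For disjoint $X,Y$: $f\star_1 g(A)=f(A\cap X)+g(A\cap Y)$. For nonempty $X$, $f\in\mathrm{Bool}(X)$ is indecomposable if $f=f'\star_1 f''$ with $f'\in\mathrm{Bool}(X\setminus Y)$, $f''\in\mathrm{Bool}(Y)$ forces $Y\in\{\emptyset,X\}$. -}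

module Defs where

open import Data.Nat using (ℕ; suc)
open import Data.Integer using (ℤ; _+_; +_)
open import Data.Fin.Subset using (Subset; ⊥; ⊤; _∩_; ∁; _⊆_; Nonempty)
open import Data.Fin.Subset.Properties using (_⊆?_)
open import Data.List using (List; filter; length)
open import Data.List.Membership.Propositional using (_∈_; _∉_)
open import Data.List.Relation.Unary.Unique.Propositional using (Unique)
open import Data.Product using (Σ; ∃; ∃-syntax; _×_; _,_)
open import Data.Sum using (_⊎_)
open import Relation.Binary.PropositionalEquality using (_≡_)

-- Ground set X = Fin n; subsets of X are  Subset n.
-- A hypergraph on Fin n: a finite set of nonempty subsets, given as a
-- duplicate-free list (so that |{Y ∈ E(H) : ...}| is the list count).
record Hypergraph (n : ℕ) : Set where
  field
    edges    : List (Subset n)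
    unique   : Unique edges
    noEmpty  : ⊥ ∉ edges

open Hypergraph public

Connected : ∀ {n} → Hypergraph n → Set
Connected {n} H =
  (P : Subset n) → Nonempty P → Nonempty (∁ P) →
  ∃[ Y ] (Y ∈ edges H × Nonempty (Y ∩ P) × Nonempty (Y ∩ ∁ P))

-- Boolean functions on X = Fin n: maps f : Subset n → ℤ with f ∅ = 0.
-- (The vanishing condition is recorded separately as IsBoolFun; γ(H)
-- satisfies it since no edge is empty.)
BoolFun : ℕ → Set
BoolFun n = Subset n → ℤ

IsBoolFun : ∀ {n} → BoolFun n → Set
IsBoolFun f = f ⊥ ≡ + 0

-- A boolean function
-- on a subset Z ⊆ X is represented by a function on subsets of X vanishing
-- at ∅, of which only the values on subsets of Z are used.
DecomposesAlong : ∀ {n} → BoolFun n → Subset n → Set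
DecomposesAlong {n} f Y =
  ∃[ g ] ∃[ h ]
    (IsBoolFun g) × (IsBoolFun h) ×
    ((A : Subset n) → f A ≡ g (A ∩ ∁ Y) + h (A ∩ Y))

-- Indecomposable (X nonempty is imposed in the statement).
Indecomposable : ∀ {n} → BoolFun n → Set
Indecomposable {n} f =
  (Y : Subset n) → DecomposesAlong f Y → (Y ≡ ⊥) ⊎ (Y ≡ ⊤)

γ : ∀ {n} → Hypergraph n → BoolFun n
γ H A = + length (filter (λ Y → Y ⊆? A) (edges H))

{-# OPTIONS --safe #-}
module Submission where

-- Since edges are nonempty, the edges
-- inside A ∩ ∁ Y and those inside A ∩ Y are disjoint families of edges
-- inside A, so γ(A) ≥ γ(A ∩ ∁ Y) + γ(A ∩ Y); equality holds for every A
-- iff no edge meets both Y and ∁ Y, and at a crossing edge A = E it is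
-- strict.  On the other hand f decomposes along Y iff
-- f(A) = f(A ∩ ∁ Y) + f(A ∩ Y) for all A, because the two factors are
-- recovered as the restrictions of f to subsets of ∁ Y and of Y.

open import Defs
open import Data.Nat as ℕ using (ℕ; suc; _≤_; _<_; z≤n; s≤s)
open import Data.Nat.Properties using (≤-antisym; <⇒≢; m≤n⇒m≤1+n; m<n⇒m<1+n; +-suc)
open import Data.Integer using (_+_; +_)
open import Data.Integer.Properties using (+-injective; pos-+; +-identityˡ; +-identityʳ)
open import Data.Fin.Subset using (Subset; ⊥; ⊤; _∩_; ∁; _⊆_; Nonempty; Empty)
open import Data.Fin.Subset.Properties
open import Data.List using (List; []; _∷_; filter; length)
open import Data.List.Properties using (filter-none)
open import Data.List.Membership.Propositional using (_∈_; find; lose)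
open import Data.List.Relation.Unary.Any using (Any; here; there; any?)
open import Data.List.Relation.Unary.All as All using (All; []; _∷_)
open import Data.List.Relation.Unary.All.Properties using (¬Any⇒All¬)
open import Data.Product using (_×_; _,_)
open import Data.Sum as Sum using (_⊎_; inj₁; inj₂; [_,_])
open import Function.Bundles using (_⇔_; mk⇔)
open import Relation.Nullary using (¬_; yes; no; contradiction)
open import Relation.Nullary.Decidable using (_×-dec_)
open import Relation.Unary using (Pred; Decidable)
open import Relation.Unary.Properties using (_∪?_)
open import Relation.Binary.PropositionalEquality using (_≡_; _≢_; refl; sym; trans; cong; cong₂; subst; module ≡-Reasoning)

count : ∀ {a p} {A : Set a} {P : Pred A p} → Decidable P → List A → ℕ
count P? xs = length (filter P? xs)

module _ {a p q} {A : Set a} {P : Pred A p} {Q : Pred A q}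
         (P? : Decidable P) (Q? : Decidable Q) where

  count-mono-≤ : ∀ {xs} → All (λ x → P x → Q x) xs → count P? xs ≤ count Q? xs
  count-mono-≤ [] = z≤n
  count-mono-≤ {x ∷ _} (P⇒Q ∷ P⇒Qs) with P? x | Q? x
  ... | yes Px | no ¬Qx = contradiction (P⇒Q Px) ¬Qx
  ... | yes _  | yes _  = s≤s (count-mono-≤ P⇒Qs)
  ... | no _   | yes _  = m≤n⇒m≤1+n (count-mono-≤ P⇒Qs)
  ... | no _   | no _   = count-mono-≤ P⇒Qs

  count-mono-< : ∀ {xs} → All (λ x → P x → Q x) xs →
                 Any (λ x → Q x × ¬ P x) xs → count P? xs < count Q? xs
  count-mono-< {x ∷ _} (_ ∷ P⇒Qs) (here (Qx , ¬Px)) with P? x | Q? x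
  ... | yes Px | _      = contradiction Px ¬Px
  ... | no _   | no ¬Qx = contradiction Qx ¬Qx
  ... | no _   | yes _  = s≤s (count-mono-≤ P⇒Qs)
  count-mono-< {x ∷ _} (P⇒Q ∷ P⇒Qs) (there witness) with P? x | Q? x
  ... | yes Px | no ¬Qx = contradiction (P⇒Q Px) ¬Qx
  ... | yes _  | yes _  = s≤s (count-mono-< P⇒Qs witness)
  ... | no _   | yes _  = m<n⇒m<1+n (count-mono-< P⇒Qs witness)
  ... | no _   | no _   = count-mono-< P⇒Qs witness

  count-∪ : ∀ {xs} → All (λ x → ¬ (P x × Q x)) xs →
            count P? xs ℕ.+ count Q? xs ≡ count (P? ∪? Q?) xs
  count-∪ [] = refl
  count-∪ {x ∷ xs} (disjoint ∷ disjoints) with P? x | Q? x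
  ... | yes Px | yes Qx = contradiction (Px , Qx) disjoint
  ... | yes _  | no _   = cong suc (count-∪ disjoints)
  ... | no _   | yes _  = trans (+-suc (count P? xs) (count Q? xs)) (cong suc (count-∪ disjoints))
  ... | no _   | no _   = count-∪ disjoints

module _ {n : ℕ} where

  Nonempty⇒≢⊥ : {p : Subset n} → Nonempty p → p ≢ ⊥
  Nonempty⇒≢⊥ (x , x∈p) refl = ∉⊥ x∈p

  Nonempty-∁⇒≢⊤ : {p : Subset n} → Nonempty (∁ p) → p ≢ ⊤
  Nonempty-∁⇒≢⊤ (x , x∈∁p) refl = x∈∁p⇒x∉p x∈∁p ∈⊤

  Empty-∁⇒≡⊤ : {p : Subset n} → Empty (∁ p) → p ≡ ⊤
  Empty-∁⇒≡⊤ ∁p-empty = ⊆-antisym ⊆⊤ (λ {x} _ → x∉∁p⇒x∈p (λ x∈∁p → ∁p-empty (x , x∈∁p)))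

  ⊆-∩⁺ : {p q r : Subset n} → p ⊆ q → p ⊆ r → p ⊆ q ∩ r
  ⊆-∩⁺ p⊆q p⊆r x∈p = x∈p∩q⁺ (p⊆q x∈p , p⊆r x∈p)

  ⊆-∁-⊆⇒Empty : {p q : Subset n} → p ⊆ ∁ q → p ⊆ q → Empty p
  ⊆-∁-⊆⇒Empty p⊆∁q p⊆q (x , x∈p) = x∈∁p⇒x∉p (p⊆∁q x∈p) (p⊆q x∈p)

  [p∩∁q]∩∁q≡p∩∁q : (p q : Subset n) → (p ∩ ∁ q) ∩ ∁ q ≡ p ∩ ∁ q
  [p∩∁q]∩∁q≡p∩∁q p q = trans (∩-assoc p (∁ q) (∁ q)) (cong (p ∩_) (∩-idem (∁ q)))

  [p∩q]∩q≡p∩q : (p q : Subset n) → (p ∩ q) ∩ q ≡ p ∩ q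
  [p∩q]∩q≡p∩q p q = trans (∩-assoc p q q) (cong (p ∩_) (∩-idem q))

  [p∩∁q]∩q≡⊥ : (p q : Subset n) → (p ∩ ∁ q) ∩ q ≡ ⊥
  [p∩∁q]∩q≡⊥ p q = trans (∩-assoc p (∁ q) q) (trans (cong (p ∩_) (∩-inverseˡ q)) (∩-zeroʳ p))

  [p∩q]∩∁q≡⊥ : (p q : Subset n) → (p ∩ q) ∩ ∁ q ≡ ⊥
  [p∩q]∩∁q≡⊥ p q = trans (∩-assoc p q (∁ q)) (trans (cong (p ∩_) (∩-inverseʳ q)) (∩-zeroʳ p))

module _ {n : ℕ} {f : BoolFun n} {Y : Subset n} where

  decomposesAlong⇒additive : DecomposesAlong f Y →
                             (A : Subset n) → f A ≡ f (A ∩ ∁ Y) + f (A ∩ Y)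
  decomposesAlong⇒additive (g , h , g⊥≡0 , h⊥≡0 , f≡g⋆h) A =
    trans (f≡g⋆h A) (cong₂ _+_ (sym f-on-∁Y) (sym f-on-Y))
    where
    open ≡-Reasoning

    f-on-∁Y : f (A ∩ ∁ Y) ≡ g (A ∩ ∁ Y)
    f-on-∁Y = begin
      f (A ∩ ∁ Y)                                   ≡⟨ f≡g⋆h (A ∩ ∁ Y) ⟩
      g ((A ∩ ∁ Y) ∩ ∁ Y) + h ((A ∩ ∁ Y) ∩ Y)       ≡⟨ cong₂ _+_ (cong g ([p∩∁q]∩∁q≡p∩∁q A Y)) (cong h ([p∩∁q]∩q≡⊥ A Y)) ⟩
      g (A ∩ ∁ Y) + h ⊥                             ≡⟨ cong (λ z → g (A ∩ ∁ Y) + z) h⊥≡0 ⟩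
      g (A ∩ ∁ Y) + + 0                             ≡⟨ +-identityʳ _ ⟩
      g (A ∩ ∁ Y)                                   ∎

    f-on-Y : f (A ∩ Y) ≡ h (A ∩ Y)
    f-on-Y = begin
      f (A ∩ Y)                                     ≡⟨ f≡g⋆h (A ∩ Y) ⟩
      g ((A ∩ Y) ∩ ∁ Y) + h ((A ∩ Y) ∩ Y)           ≡⟨ cong₂ _+_ (cong g ([p∩q]∩∁q≡⊥ A Y)) (cong h ([p∩q]∩q≡p∩q A Y)) ⟩
      g ⊥ + h (A ∩ Y)                               ≡⟨ cong (λ z → z + h (A ∩ Y)) g⊥≡0 ⟩
      + 0 + h (A ∩ Y)                               ≡⟨ +-identityˡ _ ⟩
      h (A ∩ Y)                                     ∎

  additive⇒decomposesAlong : IsBoolFun f →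
                             ((A : Subset n) → f A ≡ f (A ∩ ∁ Y) + f (A ∩ Y)) →
                             DecomposesAlong f Y
  additive⇒decomposesAlong f⊥≡0 additive = f , f , f⊥≡0 , f⊥≡0 , additive

Crosses : ∀ {n} → Subset n → Subset n → Set
Crosses Y E = Nonempty (E ∩ Y) × Nonempty (E ∩ ∁ Y)

crosses? : ∀ {n} (Y : Subset n) → Decidable (Crosses Y)
crosses? Y E = nonempty? (E ∩ Y) ×-dec nonempty? (E ∩ ∁ Y)

module _ {n : ℕ} {E Y : Subset n} where

  ¬Crosses⇒⊆∁⊎⊆ : ¬ Crosses Y E → E ⊆ ∁ Y ⊎ E ⊆ Y
  ¬Crosses⇒⊆∁⊎⊆ ¬crosses with nonempty? (E ∩ Y)
  ... | no E∩Y-empty = inj₁ λ x∈E → x∉p⇒x∈∁p λ x∈Y → E∩Y-empty (_ , x∈p∩q⁺ (x∈E , x∈Y))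
  ... | yes E∩Y-nonempty   = inj₂ λ x∈E → x∉∁p⇒x∈p λ x∈∁Y → ¬crosses (E∩Y-nonempty , _ , x∈p∩q⁺ (x∈E , x∈∁Y))

  Nonempty-∩⇒⊈∁ : Nonempty (E ∩ Y) → ¬ E ⊆ ∁ Y
  Nonempty-∩⇒⊈∁ (x , x∈E∩Y) E⊆∁Y with x∈p∩q⁻ E Y x∈E∩Y
  ... | x∈E , x∈Y = x∈∁p⇒x∉p (E⊆∁Y x∈E) x∈Y

  Nonempty-∩∁⇒⊈ : Nonempty (E ∩ ∁ Y) → ¬ E ⊆ Y
  Nonempty-∩∁⇒⊈ (x , x∈E∩∁Y) E⊆Y with x∈p∩q⁻ E (∁ Y) x∈E∩∁Y
  ... | x∈E , x∈∁Y = x∈∁p⇒x∉p x∈∁Y (E⊆Y x∈E)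

module _ {n : ℕ} (H : Hypergraph n) where

  edges-nonempty : All (λ E → ¬ Empty E) (edges H)
  edges-nonempty = All.tabulate λ E∈H E-empty →
    noEmpty H (subst (_∈ edges H) (Empty-unique E-empty) E∈H)

  γ-isBoolFun : IsBoolFun (γ H)
  γ-isBoolFun = cong (λ xs → + length xs) (filter-none (_⊆? ⊥) (All.map ⊆⊥⇒¬nonempty edges-nonempty))
    where
    ⊆⊥⇒¬nonempty : {E : Subset n} → ¬ Empty E → ¬ E ⊆ ⊥
    ⊆⊥⇒¬nonempty E-nonempty E⊆⊥ = E-nonempty λ (_ , x∈E) → ∉⊥ (E⊆⊥ x∈E)

  edgesInside : Subset n → ℕ
  edgesInside A = count (_⊆? A) (edges H)

  insideEither? : (A Y : Subset n) → Decidable (λ E → E ⊆ A ∩ ∁ Y ⊎ E ⊆ A ∩ Y)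
  insideEither? A Y = (_⊆? A ∩ ∁ Y) ∪? (_⊆? A ∩ Y)

  insideEither⇒inside : {A Y E : Subset n} → E ⊆ A ∩ ∁ Y ⊎ E ⊆ A ∩ Y → E ⊆ A
  insideEither⇒inside {A} {Y} = [ (λ E⊆ → ⊆-trans E⊆ (p∩q⊆p A (∁ Y))) , (λ E⊆ → ⊆-trans E⊆ (p∩q⊆p A Y)) ]

  edgesInside-split : (A Y : Subset n) →
    edgesInside (A ∩ ∁ Y) ℕ.+ edgesInside (A ∩ Y) ≡ count (insideEither? A Y) (edges H)
  edgesInside-split A Y = count-∪ (_⊆? A ∩ ∁ Y) (_⊆? A ∩ Y) (All.map disjoint edges-nonempty)
    where
    disjoint : {E : Subset n} → ¬ Empty E → ¬ (E ⊆ A ∩ ∁ Y × E ⊆ A ∩ Y)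
    disjoint E-nonempty (E⊆A∩∁Y , E⊆A∩Y) =
      E-nonempty (⊆-∁-⊆⇒Empty (⊆-trans E⊆A∩∁Y (p∩q⊆q A (∁ Y))) (⊆-trans E⊆A∩Y (p∩q⊆q A Y)))

  edgesInside-additive : {Y : Subset n} → All (λ E → ¬ Crosses Y E) (edges H) → (A : Subset n) →
    edgesInside A ≡ edgesInside (A ∩ ∁ Y) ℕ.+ edgesInside (A ∩ Y)
  edgesInside-additive {Y} noneCrossing A = trans
    (≤-antisym (count-mono-≤ (_⊆? A) (insideEither? A Y) (All.map insideEither noneCrossing))
               (count-mono-≤ (insideEither? A Y) (_⊆? A) (All.universal (λ _ → insideEither⇒inside) (edges H))))
    (sym (edgesInside-split A Y))
    where
    insideEither : {E : Subset n} → ¬ Crosses Y E → E ⊆ A → E ⊆ A ∩ ∁ Y ⊎ E ⊆ A ∩ Y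
    insideEither ¬crosses E⊆A = Sum.map (⊆-∩⁺ E⊆A) (⊆-∩⁺ E⊆A) (¬Crosses⇒⊆∁⊎⊆ ¬crosses)

  edgesInside-split-< : {Y E : Subset n} → E ∈ edges H → Crosses Y E →
    edgesInside (E ∩ ∁ Y) ℕ.+ edgesInside (E ∩ Y) < edgesInside E
  edgesInside-split-< {Y} {E} E∈H (E∩Y-nonempty , E∩∁Y-nonempty) =
    subst (_< edgesInside E) (sym (edgesInside-split E Y))
      (count-mono-< (insideEither? E Y) (_⊆? E)
        (All.universal (λ _ → insideEither⇒inside) (edges H))
        (lose E∈H (⊆-refl , [ notInside∁ , notInside ])))
    where
    notInside∁ : ¬ E ⊆ E ∩ ∁ Y
    notInside∁ E⊆ = Nonempty-∩⇒⊈∁ E∩Y-nonempty (⊆-trans E⊆ (p∩q⊆q E (∁ Y)))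
    notInside : ¬ E ⊆ E ∩ Y
    notInside E⊆ = Nonempty-∩∁⇒⊈ E∩∁Y-nonempty (⊆-trans E⊆ (p∩q⊆q E Y))

  γ-additive : {Y : Subset n} → All (λ E → ¬ Crosses Y E) (edges H) →
               (A : Subset n) → γ H A ≡ γ H (A ∩ ∁ Y) + γ H (A ∩ Y)
  γ-additive {Y} noneCrossing A = trans (cong +_ (edgesInside-additive noneCrossing A))
                                       (pos-+ (edgesInside (A ∩ ∁ Y)) (edgesInside (A ∩ Y)))

  γ-not-additive-at-crossing : {Y E : Subset n} → E ∈ edges H → Crosses Y E →
                               γ H E ≢ γ H (E ∩ ∁ Y) + γ H (E ∩ Y)
  γ-not-additive-at-crossing {Y} {E} E∈H crosses additive =
    <⇒≢ (edgesInside-split-< E∈H crosses)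
        (sym (+-injective (trans additive (sym (pos-+ (edgesInside (E ∩ ∁ Y)) (edgesInside (E ∩ Y)))))))

  connected⇒indecomposable : Connected H → Indecomposable (γ H)
  connected⇒indecomposable connected Y decomposes with nonempty? Y | nonempty? (∁ Y)
  ... | no Y-empty | _           = inj₁ (Empty-unique Y-empty)
  ... | yes _      | no ∁Y-empty = inj₂ (Empty-∁⇒≡⊤ ∁Y-empty)
  ... | yes Y-nonempty | yes ∁Y-nonempty with connected Y Y-nonempty ∁Y-nonempty
  ... | E , E∈H , crosses =
    contradiction (decomposesAlong⇒additive decomposes E) (γ-not-additive-at-crossing E∈H crosses)

  indecomposable⇒connected : Indecomposable (γ H) → Connected H
  indecomposable⇒connected indecomposable P P-nonempty ∁P-nonempty with any? (crosses? P) (edges H)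
  ... | yes someCrossing = find someCrossing
  ... | no ¬someCrossing =
    contradiction (indecomposable P (additive⇒decomposesAlong γ-isBoolFun (γ-additive (¬Any⇒All¬ _ ¬someCrossing))))
                  [ Nonempty⇒≢⊥ P-nonempty , Nonempty-∁⇒≢⊤ ∁P-nonempty ]

proposition4p19 : (n : ℕ) → (H : Hypergraph (suc n)) →
    Connected H ⇔ Indecomposable (γ H)
proposition4p19 n H = mk⇔ (connected⇒indecomposable H) (indecomposable⇒connected H)
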